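{- Let $G$ be a connected graph of order $n$, maximum degree $\Delta$, and diameter $d$. (i) $\gamma_{e,f}^*(G)\geq \frac{d+3}{6}$. (ii) If $\Delta=3$, then $\gamma_{e,f}^*(G)\geq \frac{n}{2+3d}$. (iii) If $\Delta\geq 4$, then $\gamma_{e,f}^*(G)\geq \left(\frac{\frac{\Delta-1}{2}-1}{\Delta\left(\frac{\Delta-1}{2}\right)^d-3}\right)n$.
   Context: Graphs are finite, simple, undirected. $\mathrm{dist}_G$ is the usual distance and the diameter is the maximum distance between vertices. $\gamma_{e,f}^*(G)$ is the optimum value of the linear program: minimize $\sum_{u\in V(G)}x(u)$ subject to $\sum_{u\in V(G)}(1/2)^{\mathrm{dist}_G(u,v)-1}x(u)\geq 1$ for every $v\in V(G)$ and $x(u)\geq0$ for every $u$.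
   Formalization: The feasible points x of the linear program defining $\gamma_{e,f}^*(G)$ take rational values. -}

module Defs where

open import Data.Nat as ℕ using (ℕ; zero; suc)
open import Data.Fin using (Fin; zero; suc)
open import Data.Bool using (Bool; true; false; if_then_else_)
open import Data.Product using (Σ; _×_; _,_; ∃)
open import Data.Integer using (+_)
open import Data.Rational as ℚ using (ℚ; 0ℚ; 1ℚ; ½; _+_; _*_)
open import Relation.Binary.PropositionalEquality using (_≡_)

record Graph (n : ℕ) : Set where
  field
    adj   : Fin n → Fin n → Bool
    sym   : ∀ u v → adj u v ≡ adj v u
    irref : ∀ v → adj v v ≡ false
open Graph public

data Walk {n : ℕ} (G : Graph n) : Fin n → Fin n → ℕ → Set where
  here : ∀ {v} → Walk G v v 0
  step : ∀ {u w v k} → adj G u w ≡ true → Walk G w v k → Walk G u v (suc k)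

Connected : ∀ {n} → Graph n → Set
Connected {n} G = ∀ (u v : Fin n) → ∃ λ k → Walk G u v k

IsDist : ∀ {n} → Graph n → (Fin n → Fin n → ℕ) → Set
IsDist {n} G dist =
  ∀ (u v : Fin n) → Walk G u v (dist u v) × (∀ k → Walk G u v k → dist u v ℕ.≤ k)

sumFin : ∀ n → (Fin n → ℕ) → ℕ
sumFin zero    f = 0
sumFin (suc n) f = f zero ℕ.+ sumFin n (λ i → f (suc i))

sumℚ : ∀ n → (Fin n → ℚ) → ℚ
sumℚ zero    f = 0ℚ
sumℚ (suc n) f = f zero + sumℚ n (λ i → f (suc i))

degree : ∀ {n} → Graph n → Fin n → ℕ
degree {n} G v = sumFin n (λ u → if adj G v u then 1 else 0)

IsMaxDegree : ∀ {n} → Graph n → ℕ → Set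
IsMaxDegree {n} G Δ = (∀ v → degree G v ℕ.≤ Δ) × ∃ λ v → degree G v ≡ Δ

IsDiameter : ∀ {n} → (Fin n → Fin n → ℕ) → ℕ → Set
IsDiameter {n} dist d = (∀ u v → dist u v ℕ.≤ d) × ∃ λ u → ∃ λ v → dist u v ≡ d

_^ℚ_ : ℚ → ℕ → ℚ
q ^ℚ zero  = 1ℚ
q ^ℚ suc k = q * (q ^ℚ k)

ℕ→ℚ : ℕ → ℚ
ℕ→ℚ m = (+ m) ℚ./ 1

-- the coefficient (1/2)^(k-1), with k = 0 giving (1/2)^(-1) = 2
weight : ℕ → ℚ
weight zero    = ℕ→ℚ 2
weight (suc k) = ½ ^ℚ k

-- x is a feasible solution of the LP defining γ*_{e,f}(G)
Feasible : ∀ {n} → (Fin n → Fin n → ℕ) → (Fin n → ℚ) → Set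
Feasible {n} dist x =
  (∀ u → 0ℚ ℚ.≤ x u) ×
  (∀ v → 1ℚ ℚ.≤ sumℚ n (λ u → weight (dist u v) * x u))

-- "γ ≥ c" for the LP optimum γ : every feasible x has objective ≥ c
-- (LowerBound dist c); we state the bounds with denominators cleared:
-- γ ≥ a / b  (b > 0) is  ∀ feasible x, a ≤ b * Σ x.
objective : ∀ {n} → (Fin n → ℚ) → ℚ
objective {n} x = sumℚ n x

module Submission where

-- Every bound is weak LP duality: if m constraints, each scaled by c ≥ 0, put total weight at most K on
-- every vertex u, then c·m ≤ K·Σx.  For (i) take the constraints along a diametral path P₀ … P_d with both
-- ends counted twice.  Helly's theorem on the line gives a position p with dist(u, Pᵢ) ≥ |i − p| for all i,
-- so the weight on u is at most Σᵢ 2^(1−|i−p|) + 2^(1−p) + 2^(1−(d−p)) = 6.  For (ii) and (iii) take every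
-- vertex once: at most Δ(Δ−1)^(k−1) vertices lie at distance k ≥ 1 from u, so the weight on u is at most
-- 2 + Δ·Σ_{k<d} ((Δ−1)/2)^k, a geometric sum.

open import Algebra.Bundles using (CommutativeMonoid; CommutativeRing)
open import Data.Bool using (true; false; if_then_else_)
import Data.Bool.Properties as Boolₚ
open import Data.Fin as Fin using (Fin; zero; suc; toℕ; punchIn)
import Data.Fin.Properties as Finₚ
open import Data.Integer using (+_)
import Data.Integer as ℤ
import Data.Integer.Properties as ℤₚ
open import Data.Integer.Solver using (module +-*-Solver)
import Data.Nat
open import Data.Nat as ℕ using (ℕ; zero; suc; _≤_; _<_; z≤n; s≤s; _∸_; ∣_-_∣)
import Data.Nat.Properties as ℕₚ
open import Data.Product using (_×_; _,_; proj₁; proj₂; ∃-syntax)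
import Data.Rational
open import Data.Rational as ℚ using (ℚ; 0ℚ; 1ℚ; ½; _+_; _*_; _-_; _/_; toℚᵘ; fromℚᵘ)
import Data.Rational.Properties as ℚₚ
open import Data.Rational.Solver renaming (module +-*-Solver to ℚSolver)
import Data.Rational.Unnormalised as ℚᵘ
import Data.Rational.Unnormalised.Properties as ℚᵘₚ
open import Data.Sum using (inj₁; inj₂)
open import Function using (_∘_)
open import Relation.Binary.PropositionalEquality
  using (_≡_; _≢_; refl; sym; trans; cong; cong₂; subst; module ≡-Reasoning)
open import Relation.Nullary using (Dec; yes; no; ¬_; contradiction)
open import Defs hiding (sym)

module _ {c ℓ} (M : CommutativeMonoid c ℓ) where
  open CommutativeMonoid M using (Carrier; _≈_; _∙_; ε; ∙-congˡ; identityʳ; setoid)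
  import Algebra.Properties.CommutativeMonoid.Sum M as Σ
  open import Relation.Binary.Reasoning.Setoid setoid

  sum-single : ∀ {n} (f : Fin n → Carrier) u → (∀ v → v ≢ u → f v ≈ ε) → Σ.sum f ≈ f u
  sum-single {suc n} f u vanish = begin
    Σ.sum f                             ≈⟨ Σ.sum-remove {i = u} f ⟩
    f u ∙ Σ.sum (λ k → f (punchIn u k)) ≈⟨ ∙-congˡ (Σ.sum-cong-≋ (λ k → vanish _ (Finₚ.punchInᵢ≢i u k))) ⟩
    f u ∙ Σ.sum {n} (λ _ → ε)           ≈⟨ ∙-congˡ (Σ.sum-replicate-zero n) ⟩
    f u ∙ ε                             ≈⟨ identityʳ (f u) ⟩
    f u                                 ∎

open import Algebra.Properties.Semiring.Sum (CommutativeRing.semiring ℚₚ.+-*-commutativeRing)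
open import Algebra.Properties.Semiring.Sum ℕₚ.+-*-semiring
  using () renaming (sum to sumℕ; sum-remove to sumℕ-remove; ∑-comm to sumℕ-comm;
                     *-distribˡ-sum to *-distribˡ-sumℕ; sum-cong-≗ to sumℕ-cong-≗)

sumℚ≡sum : ∀ n (f : Fin n → ℚ) → sumℚ n f ≡ sum f
sumℚ≡sum zero    f = refl
sumℚ≡sum (suc n) f = cong (_+_ (f zero)) (sumℚ≡sum n (λ i → f (suc i)))

sumFin≡sumℕ : ∀ n (f : Fin n → ℕ) → sumFin n f ≡ sumℕ f
sumFin≡sumℕ zero    f = refl
sumFin≡sumℕ (suc n) f = cong (f zero ℕ.+_) (sumFin≡sumℕ n (λ i → f (suc i)))

sum-mono-≤ : ∀ {n} {f g : Fin n → ℚ} → (∀ i → f i ℚ.≤ g i) → sum f ℚ.≤ sum g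
sum-mono-≤ {zero}  f≤g = ℚₚ.≤-refl
sum-mono-≤ {suc n} f≤g = ℚₚ.+-mono-≤ (f≤g zero) (sum-mono-≤ (λ i → f≤g (suc i)))

sumℕ-mono-≤ : ∀ {n} {f g : Fin n → ℕ} → (∀ i → f i ≤ g i) → sumℕ f ≤ sumℕ g
sumℕ-mono-≤ {zero}  f≤g = z≤n
sumℕ-mono-≤ {suc n} f≤g = ℕₚ.+-mono-≤ (f≤g zero) (sumℕ-mono-≤ (λ i → f≤g (suc i)))

sumℕ-mono-< : ∀ {n} {f g : Fin n → ℕ} → (∀ i → f i ≤ g i) → ∀ j → f j < g j → sumℕ f < sumℕ g
sumℕ-mono-< {suc n} {f} {g} f≤g j fj<gj
  rewrite sumℕ-remove {i = j} f | sumℕ-remove {i = j} g =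
  ℕₚ.+-mono-<-≤ fj<gj (sumℕ-mono-≤ (λ i → f≤g (punchIn j i)))

term≤sumℕ : ∀ {n} (f : Fin n → ℕ) j → f j ≤ sumℕ f
term≤sumℕ {suc n} f j rewrite sumℕ-remove {i = j} f = ℕₚ.m≤m+n (f j) _

fromℚᵘ-homo-+ : ∀ p q → fromℚᵘ (p ℚᵘ.+ q) ≡ fromℚᵘ p + fromℚᵘ q
fromℚᵘ-homo-+ p q = begin
  fromℚᵘ (p ℚᵘ.+ q)
    ≡⟨ ℚₚ.fromℚᵘ-cong (ℚᵘₚ.+-cong (ℚᵘₚ.≃-sym (ℚₚ.toℚᵘ-fromℚᵘ p)) (ℚᵘₚ.≃-sym (ℚₚ.toℚᵘ-fromℚᵘ q))) ⟩
  fromℚᵘ (toℚᵘ p′ ℚᵘ.+ toℚᵘ q′)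
    ≡⟨ ℚₚ.fromℚᵘ-cong (ℚᵘₚ.≃-sym (ℚₚ.toℚᵘ-homo-+ p′ q′)) ⟩
  fromℚᵘ (toℚᵘ (p′ + q′))
    ≡⟨ ℚₚ.fromℚᵘ-toℚᵘ (p′ + q′) ⟩
  p′ + q′ ∎
  where open ≡-Reasoning; p′ = fromℚᵘ p; q′ = fromℚᵘ q

fromℚᵘ-homo-* : ∀ p q → fromℚᵘ (p ℚᵘ.* q) ≡ fromℚᵘ p * fromℚᵘ q
fromℚᵘ-homo-* p q = begin
  fromℚᵘ (p ℚᵘ.* q)
    ≡⟨ ℚₚ.fromℚᵘ-cong (ℚᵘₚ.*-cong (ℚᵘₚ.≃-sym (ℚₚ.toℚᵘ-fromℚᵘ p)) (ℚᵘₚ.≃-sym (ℚₚ.toℚᵘ-fromℚᵘ q))) ⟩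
  fromℚᵘ (toℚᵘ p′ ℚᵘ.* toℚᵘ q′)
    ≡⟨ ℚₚ.fromℚᵘ-cong (ℚᵘₚ.≃-sym (ℚₚ.toℚᵘ-homo-* p′ q′)) ⟩
  fromℚᵘ (toℚᵘ (p′ * q′))
    ≡⟨ ℚₚ.fromℚᵘ-toℚᵘ (p′ * q′) ⟩
  p′ * q′ ∎
  where open ≡-Reasoning; p′ = fromℚᵘ p; q′ = fromℚᵘ q

-- ℕ→ℚ m is definitionally fromℚᵘ (ℕ→ℚᵘ m), so casts reduce to identities between integers.
ℕ→ℚᵘ : ℕ → ℚᵘ.ℚᵘ
ℕ→ℚᵘ m = ℚᵘ.mkℚᵘ (+ m) 0

ℕ→ℚ-+ : ∀ m n → ℕ→ℚ (m ℕ.+ n) ≡ ℕ→ℚ m + ℕ→ℚ n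
ℕ→ℚ-+ m n = begin
  fromℚᵘ (ℕ→ℚᵘ (m ℕ.+ n))      ≡⟨ ℚₚ.fromℚᵘ-cong {ℕ→ℚᵘ (m ℕ.+ n)} {ℕ→ℚᵘ m ℚᵘ.+ ℕ→ℚᵘ n} (ℚᵘ.*≡* numerators) ⟩
  fromℚᵘ (ℕ→ℚᵘ m ℚᵘ.+ ℕ→ℚᵘ n)   ≡⟨ fromℚᵘ-homo-+ (ℕ→ℚᵘ m) (ℕ→ℚᵘ n) ⟩
  ℕ→ℚ m + ℕ→ℚ n                 ∎
  where
  open ≡-Reasoning
  open +-*-Solver
  numerators : + (m ℕ.+ n) ℤ.* + 1 ≡ (+ m ℤ.* + 1 ℤ.+ + n ℤ.* + 1) ℤ.* + 1
  numerators rewrite ℤₚ.pos-+ m n =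
    solve 2 (λ a b → (a :+ b) :* con (+ 1) := (a :* con (+ 1) :+ b :* con (+ 1)) :* con (+ 1)) refl (+ m) (+ n)

ℕ→ℚ-* : ∀ m n → ℕ→ℚ (m ℕ.* n) ≡ ℕ→ℚ m * ℕ→ℚ n
ℕ→ℚ-* m n = begin
  fromℚᵘ (ℕ→ℚᵘ (m ℕ.* n))      ≡⟨ ℚₚ.fromℚᵘ-cong {ℕ→ℚᵘ (m ℕ.* n)} {ℕ→ℚᵘ m ℚᵘ.* ℕ→ℚᵘ n} (ℚᵘ.*≡* numerators) ⟩
  fromℚᵘ (ℕ→ℚᵘ m ℚᵘ.* ℕ→ℚᵘ n)   ≡⟨ fromℚᵘ-homo-* (ℕ→ℚᵘ m) (ℕ→ℚᵘ n) ⟩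
  ℕ→ℚ m * ℕ→ℚ n                 ∎
  where
  open ≡-Reasoning
  numerators : + (m ℕ.* n) ℤ.* + 1 ≡ (+ m ℤ.* + n) ℤ.* + 1
  numerators = cong (ℤ._* + 1) (ℤₚ.pos-* m n)

[m/2]≡½*m : ∀ m → (+ m) / 2 ≡ ½ * ℕ→ℚ m
[m/2]≡½*m m = begin
  fromℚᵘ (ℚᵘ.mkℚᵘ (+ m) 1)     ≡⟨ ℚₚ.fromℚᵘ-cong {ℚᵘ.mkℚᵘ (+ m) 1} {toℚᵘ ½ ℚᵘ.* ℕ→ℚᵘ m} (ℚᵘ.*≡* cross) ⟩
  fromℚᵘ (toℚᵘ ½ ℚᵘ.* ℕ→ℚᵘ m)   ≡⟨ fromℚᵘ-homo-* (toℚᵘ ½) (ℕ→ℚᵘ m) ⟩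
  ½ * ℕ→ℚ m                     ∎
  where
  open ≡-Reasoning
  open +-*-Solver
  cross : + m ℤ.* (+ 2 ℤ.* + 1) ≡ (+ 1 ℤ.* + m) ℤ.* + 2
  cross = solve 1 (λ a → a :* (con (+ 2) :* con (+ 1)) := (con (+ 1) :* a) :* con (+ 2)) refl (+ m)

ℕ→ℚ-^ : ∀ m k → ℕ→ℚ (m ℕ.^ k) ≡ ℕ→ℚ m ^ℚ k
ℕ→ℚ-^ m zero    = refl
ℕ→ℚ-^ m (suc k) = trans (ℕ→ℚ-* m (m ℕ.^ k)) (cong (ℕ→ℚ m *_) (ℕ→ℚ-^ m k))

ℕ→ℚ-sum : ∀ {n} (f : Fin n → ℕ) → ℕ→ℚ (sumℕ f) ≡ ∑[ i < n ] ℕ→ℚ (f i)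
ℕ→ℚ-sum {zero}  f = refl
ℕ→ℚ-sum {suc n} f = trans (ℕ→ℚ-+ (f zero) _) (cong (_+_ (ℕ→ℚ (f zero))) (ℕ→ℚ-sum (λ i → f (suc i))))

ℕ→ℚ-nonNeg : ∀ m → 0ℚ ℚ.≤ ℕ→ℚ m
ℕ→ℚ-nonNeg m = ℚₚ.nonNegative⁻¹ (ℕ→ℚ m) {{ℚₚ.normalize-nonNeg m 1}}

ℕ→ℚ-mono-≤ : ∀ {m n} → m ≤ n → ℕ→ℚ m ℚ.≤ ℕ→ℚ n
ℕ→ℚ-mono-≤ {m} {n} m≤n = begin
  ℕ→ℚ m                   ≡⟨ ℚₚ.+-identityʳ (ℕ→ℚ m) ⟨
  ℕ→ℚ m + 0ℚ              ≤⟨ ℚₚ.+-monoʳ-≤ (ℕ→ℚ m) (ℕ→ℚ-nonNeg (n ∸ m)) ⟩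
  ℕ→ℚ m + ℕ→ℚ (n ∸ m)     ≡⟨ ℕ→ℚ-+ m (n ∸ m) ⟨
  ℕ→ℚ (m ℕ.+ (n ∸ m))     ≡⟨ cong ℕ→ℚ (ℕₚ.m+[n∸m]≡n m≤n) ⟩
  ℕ→ℚ n                   ∎
  where open ℚₚ.≤-Reasoning

sum-const : ∀ n c → ∑[ i < n ] c ≡ ℕ→ℚ n * c
sum-const zero    c = sym (ℚₚ.*-zeroˡ c)
sum-const (suc n) c = begin
  c + ∑[ i < n ] c        ≡⟨ cong (_+_ c) (sum-const n c) ⟩
  c + ℕ→ℚ n * c           ≡⟨ solve 2 (λ c m → c :+ m :* c := (con 1ℚ :+ m) :* c) refl c (ℕ→ℚ n) ⟩
  (1ℚ + ℕ→ℚ n) * c        ≡⟨ cong (_* c) (ℕ→ℚ-+ 1 n) ⟨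
  ℕ→ℚ (suc n) * c         ∎
  where open ≡-Reasoning; open ℚSolver

*-distrib-^ℚ : ∀ p q k → (p * q) ^ℚ k ≡ p ^ℚ k * q ^ℚ k
*-distrib-^ℚ p q zero    = refl
*-distrib-^ℚ p q (suc k) = begin
  p * q * (p * q) ^ℚ k
    ≡⟨ cong (p * q *_) (*-distrib-^ℚ p q k) ⟩
  p * q * (p ^ℚ k * q ^ℚ k)
    ≡⟨ solve 4 (λ p q a b → p :* q :* (a :* b) := p :* a :* (q :* b)) refl p q (p ^ℚ k) (q ^ℚ k) ⟩
  p * p ^ℚ k * (q * q ^ℚ k) ∎
  where open ≡-Reasoning; open ℚSolver

1^ℚ : ∀ k → 1ℚ ^ℚ k ≡ 1ℚ
1^ℚ zero    = refl
1^ℚ (suc k) = trans (ℚₚ.*-identityˡ _) (1^ℚ k)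

geometric-sum : ∀ q d → (q - 1ℚ) * ∑[ k < d ] q ^ℚ toℕ k ≡ q ^ℚ d - 1ℚ
geometric-sum q zero    = ℚₚ.*-zeroʳ (q - 1ℚ)
geometric-sum q (suc d) = begin
  (q - 1ℚ) * (1ℚ + ∑[ k < d ] (q * q ^ℚ toℕ k))
    ≡⟨ cong (λ s → (q - 1ℚ) * (1ℚ + s)) (*-distribˡ-sum {d} q (λ k → q ^ℚ toℕ k)) ⟨
  (q - 1ℚ) * (1ℚ + q * S)
    ≡⟨ solve 2 (λ q s → (q :- con 1ℚ) :* (con 1ℚ :+ q :* s) := (q :- con 1ℚ) :+ q :* ((q :- con 1ℚ) :* s)) refl q S ⟩
  (q - 1ℚ) + q * ((q - 1ℚ) * S)
    ≡⟨ cong (λ t → (q - 1ℚ) + q * t) (geometric-sum q d) ⟩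
  (q - 1ℚ) + q * (q ^ℚ d - 1ℚ)
    ≡⟨ solve 2 (λ q t → (q :- con 1ℚ) :+ q :* (t :- con 1ℚ) := q :* t :- con 1ℚ) refl q (q ^ℚ d) ⟩
  q * q ^ℚ d - 1ℚ ∎
  where open ≡-Reasoning; open ℚSolver; S = ∑[ k < d ] q ^ℚ toℕ k

weight-halves : ∀ k → weight (suc k) + weight (suc k) ≡ weight k
weight-halves zero    = refl
weight-halves (suc k) = solve 1 (λ w → con ½ :* w :+ con ½ :* w := w) refl (½ ^ℚ k)
  where open ℚSolver

weight-nonNeg : ∀ k → 0ℚ ℚ.≤ weight k
weight-nonNeg zero          = ℕ→ℚ-nonNeg 2
weight-nonNeg (suc zero)    = ℕ→ℚ-nonNeg 1
weight-nonNeg (suc (suc k)) = ℚₚ.*-monoˡ-≤-nonNeg ½ (weight-nonNeg (suc k))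

weight-suc≤ : ∀ k → weight (suc k) ℚ.≤ weight k
weight-suc≤ k = begin
  weight (suc k)                   ≡⟨ ℚₚ.+-identityʳ _ ⟨
  weight (suc k) + 0ℚ              ≤⟨ ℚₚ.+-monoʳ-≤ (weight (suc k)) (weight-nonNeg (suc k)) ⟩
  weight (suc k) + weight (suc k)  ≡⟨ weight-halves k ⟩
  weight k                         ∎
  where open ℚₚ.≤-Reasoning

weight-antitone : ∀ {k m} → k ≤ m → weight m ℚ.≤ weight k
weight-antitone = antitone′ ∘ ℕₚ.≤⇒≤′
  where
  antitone′ : ∀ {k m} → k ℕ.≤′ m → weight m ℚ.≤ weight k
  antitone′ ℕ.≤′-refl            = ℚₚ.≤-refl
  antitone′ (ℕ.≤′-step {m} k≤′m) = ℚₚ.≤-trans (weight-suc≤ m) (antitone′ k≤′m)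

weight-sum+last : ∀ k → ∑[ i < suc k ] weight (toℕ i) + weight k ≡ ℕ→ℚ 4
weight-sum+last zero    = refl
weight-sum+last (suc k) = begin
  ∑[ i < suc (suc k) ] weight (toℕ i) + w
    ≡⟨ cong (_+ w) (sum-init-last {suc k} (weight ∘ toℕ)) ⟩
  (∑[ i < suc k ] weight (toℕ (Fin.inject₁ i)) + weight (toℕ (Fin.fromℕ (suc k)))) + w
    ≡⟨ cong₂ (λ s l → s + weight l + w) (sum-cong-≗ {suc k} (cong weight ∘ Finₚ.toℕ-inject₁)) (Finₚ.toℕ-fromℕ (suc k)) ⟩
  (S + w) + w   ≡⟨ ℚₚ.+-assoc S w w ⟩
  S + (w + w)   ≡⟨ cong (_+_ S) (weight-halves k) ⟩
  S + weight k  ≡⟨ weight-sum+last k ⟩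
  ℕ→ℚ 4         ∎
  where open ≡-Reasoning; w = weight (suc k); S = ∑[ i < suc k ] weight (toℕ i)

-- On either side of p the terms, together with the extra end term, sum to 2 = weight 0.
weight-profile : ∀ {L p} → p ≤ L → weight p + (weight ∣ L - p ∣ + ∑[ i < suc L ] weight ∣ toℕ i - p ∣) ≡ ℕ→ℚ 6
weight-profile {L} z≤n = begin
  ℕ→ℚ 2 + (weight ∣ L - 0 ∣ + ∑[ i < suc L ] weight ∣ toℕ i - 0 ∣)
    ≡⟨ cong₂ (λ l s → ℕ→ℚ 2 + (weight l + s)) (ℕₚ.∣-∣-identityʳ L) (sum-cong-≗ {suc L} (cong weight ∘ ℕₚ.∣-∣-identityʳ ∘ toℕ)) ⟩
  ℕ→ℚ 2 + (weight L + ∑[ i < suc L ] weight (toℕ i))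
    ≡⟨ cong (_+_ (ℕ→ℚ 2)) (trans (ℚₚ.+-comm (weight L) _) (weight-sum+last L)) ⟩
  ℕ→ℚ 6 ∎
  where open ≡-Reasoning
weight-profile {suc L} {suc p} (s≤s p≤L) = begin
  w + (weight ∣ L - p ∣ + (w + S))
    ≡⟨ solve 3 (λ w l s → w :+ (l :+ (w :+ s)) := (w :+ w) :+ (l :+ s)) refl w (weight ∣ L - p ∣) S ⟩
  (w + w) + (weight ∣ L - p ∣ + S)
    ≡⟨ cong (_+ (weight ∣ L - p ∣ + S)) (weight-halves p) ⟩
  weight p + (weight ∣ L - p ∣ + S)
    ≡⟨ weight-profile p≤L ⟩
  ℕ→ℚ 6 ∎
  where open ≡-Reasoning; open ℚSolver; w = weight (suc p); S = ∑[ i < suc L ] weight ∣ toℕ i - p ∣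

∣m-n∣≤o : ∀ {m n o} → m ≤ n ℕ.+ o → n ≤ m ℕ.+ o → ∣ m - n ∣ ≤ o
∣m-n∣≤o {zero}  {n}     _           n≤o         = n≤o
∣m-n∣≤o {suc m} {zero}  m≤o         _           = m≤o
∣m-n∣≤o {suc m} {suc n} (s≤s m≤n+o) (s≤s n≤m+o) = ∣m-n∣≤o m≤n+o n≤m+o

m∸n≤o⇒m≤o+n : ∀ {m n o} → m ∸ n ≤ o → m ≤ o ℕ.+ n
m∸n≤o⇒m≤o+n {m} {n} {o} m∸n≤o = begin
  m                ≤⟨ ℕₚ.m≤n+m∸n m n ⟩
  n ℕ.+ (m ∸ n)    ≤⟨ ℕₚ.+-monoʳ-≤ n m∸n≤o ⟩
  n ℕ.+ o          ≡⟨ ℕₚ.+-comm n o ⟩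
  o ℕ.+ n          ∎
  where open ℕₚ.≤-Reasoning

extend-≤ : ∀ {L} {P : ℕ → Set} → (∀ {i} → i ≤ L → P i) → P (suc L) → ∀ {i} → i ≤ suc L → P i
extend-≤ below top i≤1+L with ℕₚ.m≤n⇒m<n∨m≡n i≤1+L
... | inj₁ i<1+L = below (ℕ.s≤s⁻¹ i<1+L)
... | inj₂ refl  = top

-- Helly's theorem on the line: the intervals [i - f i, i + f i], i ≤ L, meet pairwise, hence share a
-- point.  When interval L+1 is added, the common point is kept if it lies in it, and otherwise moved
-- to its left end.
helly-ℕ : ∀ L (f : ℕ → ℕ) → (∀ {i j} → i ≤ j → j ≤ L → j ≤ i ℕ.+ f i ℕ.+ f j) →
          ∃[ p ] p ≤ L × (∀ {i} → i ≤ L → ∣ i - p ∣ ≤ f i)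
helly-ℕ zero    f meet = 0 , z≤n , λ { z≤n → z≤n }
helly-ℕ (suc L) f meet with helly-ℕ L f (λ i≤j j≤L → meet i≤j (ℕₚ.m≤n⇒m≤1+n j≤L))
... | p , p≤L , near with suc L ∸ f (suc L) ℕ.≤? p
...   | yes left≤p = p , ℕₚ.m≤n⇒m≤1+n p≤L ,
          extend-≤ near (∣m-n∣≤o (m∸n≤o⇒m≤o+n left≤p) (ℕₚ.≤-trans (ℕₚ.m≤n⇒m≤1+n p≤L) (ℕₚ.m≤m+n (suc L) _)))
...   | no  left≰p = left , ℕₚ.m∸n≤m (suc L) (f (suc L)) ,
          extend-≤ (λ i≤L → ∣m-n∣≤o (i≤left+f i≤L) (left≤i+f i≤L))
                   (∣m-n∣≤o (m∸n≤o⇒m≤o+n {n = f (suc L)} ℕₚ.≤-refl)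
                            (ℕₚ.≤-trans (ℕₚ.m∸n≤m (suc L) (f (suc L))) (ℕₚ.m≤m+n (suc L) _)))
  where
  left = suc L ∸ f (suc L)
  i≤left+f : ∀ {i} → i ≤ L → i ≤ left ℕ.+ f i
  i≤left+f {i} i≤L = ℕₚ.≤-trans (ℕₚ.m≤n+∣m-n∣ i p) (ℕₚ.+-mono-≤ (ℕₚ.<⇒≤ (ℕₚ.≰⇒> left≰p)) (near i≤L))
  left≤i+f : ∀ {i} → i ≤ L → left ≤ i ℕ.+ f i
  left≤i+f {i} i≤L = ℕₚ.m≤n+o⇒m∸n≤o (suc L) (f (suc L))
    (subst (suc L ≤_) (ℕₚ.+-comm (i ℕ.+ f i) (f (suc L))) (meet (ℕₚ.m≤n⇒m≤1+n i≤L) ℕₚ.≤-refl))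

𝟙 : ∀ {a} {A : Set a} → Dec A → ℕ
𝟙 (yes _) = 1
𝟙 (no _)  = 0

𝟙-yes : ∀ {a} {A : Set a} (A? : Dec A) → A → 𝟙 A? ≡ 1
𝟙-yes (yes _) _ = refl
𝟙-yes (no ¬a) a = contradiction a ¬a

𝟙-no : ∀ {a} {A : Set a} (A? : Dec A) → ¬ A → 𝟙 A? ≡ 0
𝟙-no (yes a) ¬a = contradiction a ¬a
𝟙-no (no _)  _  = refl

𝟙-≤ : ∀ {a} {A : Set a} {m} (A? : Dec A) → (A → 1 ≤ m) → 𝟙 A? ≤ m
𝟙-≤ (yes a) 1≤m = 1≤m a
𝟙-≤ (no _)  _   = z≤n

𝟙≤1 : ∀ {a} {A : Set a} (A? : Dec A) → 𝟙 A? ≤ 1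
𝟙≤1 (yes _) = ℕₚ.≤-refl
𝟙≤1 (no _)  = z≤n

𝟙*𝟙≤𝟙 : ∀ {a b} {A : Set a} {B : Set b} (A? : Dec A) (B? : Dec B) → 𝟙 A? ℕ.* 𝟙 B? ≤ 𝟙 A?
𝟙*𝟙≤𝟙 (no _)  _       = z≤n
𝟙*𝟙≤𝟙 (yes _) (no _)  = z≤n
𝟙*𝟙≤𝟙 (yes _) (yes _) = ℕₚ.≤-refl

degree≡sumℕ : ∀ {n} (G : Graph n) v → degree G v ≡ sumℕ (λ w → 𝟙 (adj G v w Boolₚ.≟ true))
degree≡sumℕ {n} G v = trans (sumFin≡sumℕ n _) (sumℕ-cong-≗ (λ w → indicator (adj G v w)))
  where
  indicator : ∀ b → (if b then 1 else 0) ≡ 𝟙 (b Boolₚ.≟ true)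
  indicator true  = refl
  indicator false = refl

sum-𝟙-≟ : ∀ {D m} → m ≤ D → (g : ℕ → ℚ) → ∑[ k < suc D ] (ℕ→ℚ (𝟙 (m ℕ.≟ toℕ k)) * g (toℕ k)) ≡ g m
sum-𝟙-≟ {D} {m} m≤D g = begin
  ∑[ k < suc D ] (ℕ→ℚ (𝟙 (m ℕ.≟ toℕ k)) * g (toℕ k))   ≡⟨ sum-single ℚₚ.+-0-commutativeMonoid _ m′ vanish ⟩
  ℕ→ℚ (𝟙 (m ℕ.≟ toℕ m′)) * g (toℕ m′)                 ≡⟨ cong (λ t → ℕ→ℚ (𝟙 (m ℕ.≟ t)) * g t) (Finₚ.toℕ-fromℕ< (s≤s m≤D)) ⟩
  ℕ→ℚ (𝟙 (m ℕ.≟ m)) * g m                             ≡⟨ cong (λ b → ℕ→ℚ b * g m) (𝟙-yes (m ℕ.≟ m) refl) ⟩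
  1ℚ * g m                                            ≡⟨ ℚₚ.*-identityˡ (g m) ⟩
  g m                                                 ∎
  where
  open ≡-Reasoning
  m′ = Fin.fromℕ< (s≤s m≤D)
  at-m′ : ∀ {k} → m ≡ toℕ k → toℕ k ≡ toℕ m′
  at-m′ m≡k = trans (sym m≡k) (sym (Finₚ.toℕ-fromℕ< (s≤s m≤D)))
  vanish : ∀ k → k ≢ m′ → ℕ→ℚ (𝟙 (m ℕ.≟ toℕ k)) * g (toℕ k) ≡ 0ℚ
  vanish k k≢m′ rewrite 𝟙-no (m ℕ.≟ toℕ k) (k≢m′ ∘ Finₚ.toℕ-injective ∘ at-m′) = ℚₚ.*-zeroˡ (g (toℕ k))

sum-by-level : ∀ {n} D (h : Fin n → ℕ) (g : ℕ → ℚ) → (∀ v → h v ≤ D) →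
               ∑[ v < n ] g (h v) ≡ ∑[ k < suc D ] (ℕ→ℚ (sumℕ (λ v → 𝟙 (h v ℕ.≟ toℕ k))) * g (toℕ k))
sum-by-level {n} D h g h≤D = begin
  ∑[ v < n ] g (h v)
    ≡⟨ sum-cong-≗ {n} (λ v → sum-𝟙-≟ (h≤D v) g) ⟨
  ∑[ v < n ] ∑[ k < suc D ] (ℕ→ℚ (𝟙 (h v ℕ.≟ toℕ k)) * g (toℕ k))
    ≡⟨ ∑-comm {n} {suc D} (λ v k → ℕ→ℚ (𝟙 (h v ℕ.≟ toℕ k)) * g (toℕ k)) ⟩
  ∑[ k < suc D ] ∑[ v < n ] (ℕ→ℚ (𝟙 (h v ℕ.≟ toℕ k)) * g (toℕ k))
    ≡⟨ sum-cong-≗ {suc D} level ⟨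
  ∑[ k < suc D ] (ℕ→ℚ (sumℕ (λ v → 𝟙 (h v ℕ.≟ toℕ k))) * g (toℕ k)) ∎
  where
  open ≡-Reasoning
  level : ∀ k → ℕ→ℚ (sumℕ (λ v → 𝟙 (h v ℕ.≟ toℕ k))) * g (toℕ k) ≡ ∑[ v < n ] (ℕ→ℚ (𝟙 (h v ℕ.≟ toℕ k)) * g (toℕ k))
  level k = trans (cong (_* g (toℕ k)) (ℕ→ℚ-sum (λ v → 𝟙 (h v ℕ.≟ toℕ k)))) (*-distribʳ-sum {n} (g (toℕ k)) _)

growth : ℕ → ℚ
growth Δ = (+ (Δ ∸ 1)) / 2

growth-identity : ∀ m d → (growth (suc m) - ℕ→ℚ 1) * (ℕ→ℚ 2 + ℕ→ℚ (suc m) * ∑[ k < d ] growth (suc m) ^ℚ toℕ k)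
                          ≡ ℕ→ℚ (suc m) * growth (suc m) ^ℚ d - ℕ→ℚ 3
growth-identity m d = begin
  (q - 1ℚ) * (ℕ→ℚ 2 + Δ * S)
    ≡⟨ solve 3 (λ q Δ S → (q :- con 1ℚ) :* (con (ℕ→ℚ 2) :+ Δ :* S)
                        := (con (ℕ→ℚ 2) :* q :- con (ℕ→ℚ 2)) :+ Δ :* ((q :- con 1ℚ) :* S)) refl q Δ S ⟩
  (ℕ→ℚ 2 * q - ℕ→ℚ 2) + Δ * ((q - 1ℚ) * S)
    ≡⟨ cong₂ (λ a b → (a - ℕ→ℚ 2) + Δ * b) 2q≡m (geometric-sum q d) ⟩
  (ℕ→ℚ m - ℕ→ℚ 2) + Δ * (q ^ℚ d - 1ℚ)
    ≡⟨ cong (λ Δ → (ℕ→ℚ m - ℕ→ℚ 2) + Δ * (q ^ℚ d - 1ℚ)) (ℕ→ℚ-+ 1 m) ⟩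
  (ℕ→ℚ m - ℕ→ℚ 2) + (1ℚ + ℕ→ℚ m) * (q ^ℚ d - 1ℚ)
    ≡⟨ solve 2 (λ M Q → (M :- con (ℕ→ℚ 2)) :+ (con 1ℚ :+ M) :* (Q :- con 1ℚ) := (con 1ℚ :+ M) :* Q :- con (ℕ→ℚ 3)) refl (ℕ→ℚ m) (q ^ℚ d) ⟩
  (1ℚ + ℕ→ℚ m) * q ^ℚ d - ℕ→ℚ 3
    ≡⟨ cong (λ Δ → Δ * q ^ℚ d - ℕ→ℚ 3) (ℕ→ℚ-+ 1 m) ⟨
  Δ * q ^ℚ d - ℕ→ℚ 3 ∎
  where
  open ≡-Reasoning
  open ℚSolver
  q = growth (suc m)
  Δ = ℕ→ℚ (suc m)
  S = ∑[ k < d ] q ^ℚ toℕ k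
  2q≡m : ℕ→ℚ 2 * q ≡ ℕ→ℚ m
  2q≡m = trans (cong (ℕ→ℚ 2 *_) ([m/2]≡½*m m)) (solve 1 (λ M → con (ℕ→ℚ 2) :* (con ½ :* M) := M) refl (ℕ→ℚ m))

ℕ→ℚ-^*½^ : ∀ m k → ℕ→ℚ (m ℕ.^ k) * ½ ^ℚ k ≡ ((+ m) / 2) ^ℚ k
ℕ→ℚ-^*½^ m k = begin
  ℕ→ℚ (m ℕ.^ k) * ½ ^ℚ k      ≡⟨ cong (_* ½ ^ℚ k) (ℕ→ℚ-^ m k) ⟩
  ℕ→ℚ m ^ℚ k * ½ ^ℚ k         ≡⟨ *-distrib-^ℚ (ℕ→ℚ m) ½ k ⟨
  (ℕ→ℚ m * ½) ^ℚ k            ≡⟨ cong (_^ℚ k) (trans (ℚₚ.*-comm (ℕ→ℚ m) ½) (sym ([m/2]≡½*m m))) ⟩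
  ((+ m) / 2) ^ℚ k            ∎
  where open ≡-Reasoning

weak-duality : ∀ {n m} (dist : Fin n → Fin n → ℕ) (x : Fin n → ℚ) → Feasible dist x →
               (vs : Fin m → Fin n) (c K : ℚ) → 0ℚ ℚ.≤ c →
               (∀ u → c * ∑[ j < m ] weight (dist u (vs j)) ℚ.≤ K) → c * ℕ→ℚ m ℚ.≤ K * objective x
weak-duality {n} {m} dist x (x≥0 , covered) vs c K c≥0 load≤K = begin
  c * ℕ→ℚ m
    ≡⟨ trans (sum-const m c) (ℚₚ.*-comm (ℕ→ℚ m) c) ⟨
  ∑[ j < m ] c
    ≤⟨ sum-mono-≤ (λ j → c≤c*coverage (vs j)) ⟩
  ∑[ j < m ] (c * coverage (vs j))
    ≡⟨ sum-cong-≗ {m} (λ j → *-distribˡ-sum c (λ u → weight (dist u (vs j)) * x u)) ⟩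
  ∑[ j < m ] ∑[ u < n ] (c * (weight (dist u (vs j)) * x u))
    ≡⟨ ∑-comm (λ j u → c * (weight (dist u (vs j)) * x u)) ⟩
  ∑[ u < n ] ∑[ j < m ] (c * (weight (dist u (vs j)) * x u))
    ≡⟨ sum-cong-≗ {n} factor ⟨
  ∑[ u < n ] (x u * (c * load u))
    ≤⟨ sum-mono-≤ (λ u → ℚₚ.*-monoˡ-≤-nonNeg (x u) {{ℚ.nonNegative (x≥0 u)}} (load≤K u)) ⟩
  ∑[ u < n ] (x u * K)
    ≡⟨ *-distribʳ-sum K x ⟨
  sum x * K
    ≡⟨ trans (cong (K *_) (sumℚ≡sum n x)) (ℚₚ.*-comm K (sum x)) ⟨
  K * objective x ∎
  where
  open ℚₚ.≤-Reasoning
  coverage : Fin n → ℚ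
  coverage v = ∑[ u < n ] (weight (dist u v) * x u)
  load : Fin n → ℚ
  load u = ∑[ j < m ] weight (dist u (vs j))
  c≤c*coverage : ∀ v → c ℚ.≤ c * coverage v
  c≤c*coverage v = ℚₚ.≤-trans (ℚₚ.≤-reflexive (sym (ℚₚ.*-identityʳ c)))
    (ℚₚ.*-monoˡ-≤-nonNeg c {{ℚ.nonNegative c≥0}} (subst (1ℚ ℚ.≤_) (sumℚ≡sum n _) (covered v)))
  factor : ∀ u → x u * (c * load u) ≡ ∑[ j < m ] (c * (weight (dist u (vs j)) * x u))
  factor u = begin-equality
    x u * (c * load u)
      ≡⟨ cong (x u *_) (*-distribˡ-sum c (λ j → weight (dist u (vs j)))) ⟩
    x u * ∑[ j < m ] (c * weight (dist u (vs j)))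
      ≡⟨ *-distribˡ-sum (x u) (λ j → c * weight (dist u (vs j))) ⟩
    ∑[ j < m ] (x u * (c * weight (dist u (vs j))))
      ≡⟨ sum-cong-≗ {m} (λ j → solve 3 (λ y c w → y :* (c :* w) := c :* (w :* y)) refl (x u) c (weight (dist u (vs j)))) ⟩
    ∑[ j < m ] (c * (weight (dist u (vs j)) * x u)) ∎
    where open ℚSolver

-- The dual solution for (i): both ends of the diametral path twice, its other vertices once.
endsTwiceAlong : ∀ d → Fin (3 ℕ.+ d) → ℕ
endsTwiceAlong d zero          = 0
endsTwiceAlong d (suc zero)    = d
endsTwiceAlong d (suc (suc i)) = toℕ i

endsTwiceAlong≤ : ∀ d j → endsTwiceAlong d j ≤ d
endsTwiceAlong≤ d zero          = z≤n
endsTwiceAlong≤ d (suc zero)    = ℕₚ.≤-refl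
endsTwiceAlong≤ d (suc (suc i)) = Finₚ.toℕ≤pred[n] i

module _ {n} {G : Graph n} where

  _∷ʳ_ : ∀ {u v w k} → Walk G u v k → adj G v w ≡ true → Walk G u w (suc k)
  here      ∷ʳ e = step e here
  step e′ W ∷ʳ e = step e′ (W ∷ʳ e)

  reverse : ∀ {u v k} → Walk G u v k → Walk G v u k
  reverse here                   = here
  reverse {u} (step {w = w} e W) = reverse W ∷ʳ trans (Graph.sym G w u) e

  _++_ : ∀ {u v w k m} → Walk G u v k → Walk G v w m → Walk G u w (k ℕ.+ m)
  here     ++ W′ = W′
  step e W ++ W′ = step e (W ++ W′)

  vertexAt : ∀ {u v k} → Walk G u v k → ℕ → Fin n
  vertexAt {u} here       i       = u
  vertexAt {u} (step e W) zero    = u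
  vertexAt     (step e W) (suc i) = vertexAt W i

  take : ∀ {u v k i} (W : Walk G u v k) → i ≤ k → Walk G u (vertexAt W i) i
  take here       z≤n     = here
  take (step e W) z≤n     = here
  take (step e W) (s≤s p) = step e (take W p)

  drop : ∀ {u v k i} (W : Walk G u v k) → i ≤ k → Walk G (vertexAt W i) v (k ∸ i)
  drop here       z≤n     = here
  drop (step e W) z≤n     = step e W
  drop (step e W) (s≤s p) = drop W p

sphere : ∀ {n} → (Fin n → Fin n → ℕ) → Fin n → ℕ → ℕ
sphere dist u k = sumℕ (λ v → 𝟙 (dist v u ℕ.≟ k))

module _ {n} {G : Graph n} {dist : Fin n → Fin n → ℕ} (isDist : IsDist G dist) where

  shortest : ∀ u v → Walk G u v (dist u v)
  shortest u v = proj₁ (isDist u v)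

  dist-minimal : ∀ {u v k} → Walk G u v k → dist u v ≤ k
  dist-minimal {u} {v} = proj₂ (isDist u v) _

  dist-sym : ∀ u v → dist u v ≡ dist v u
  dist-sym u v = ℕₚ.≤-antisym (dist-minimal (reverse (shortest v u))) (dist-minimal (reverse (shortest u v)))

  dist≡0⇒≡ : ∀ {u v} → dist u v ≡ 0 → u ≡ v
  dist≡0⇒≡ {u} {v} d≡0 = endpoints (subst (Walk G u v) d≡0 (shortest u v))
    where
    endpoints : Walk G u v 0 → u ≡ v
    endpoints here = refl

  shortest-step : ∀ {v u k} → dist v u ≡ suc k → ∃[ w ] adj G v w ≡ true × dist w u ≡ k
  shortest-step {v} {u} {k} d≡1+k = first-step (subst (Walk G v u) d≡1+k (shortest v u))
    where
    first-step : Walk G v u (suc k) → ∃[ w ] adj G v w ≡ true × dist w u ≡ k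
    first-step (step {w = w} e W) = w , e , ℕₚ.≤-antisym (dist-minimal W) (ℕ.s≤s⁻¹ (begin
      suc k                  ≡⟨ d≡1+k ⟨
      dist v u               ≤⟨ dist-minimal (step e (shortest w u)) ⟩
      suc (dist w u)         ∎))
      where open ℕₚ.≤-Reasoning

  -- the walk a → vᵢ → u → vⱼ → b is no shorter than the geodesic a → b
  geodesic-detour : ∀ {a b d} (W : Walk G a b d) → dist a b ≡ d → ∀ u {i j} → i ≤ j → j ≤ d →
                    j ≤ i ℕ.+ dist u (vertexAt W i) ℕ.+ dist u (vertexAt W j)
  geodesic-detour {a} {b} {d} W geo u {i} {j} i≤j j≤d = ℕₚ.+-cancelʳ-≤ (d ∸ j) j (i ℕ.+ fᵢ ℕ.+ fⱼ) (begin
    j ℕ.+ (d ∸ j)                       ≡⟨ ℕₚ.m+[n∸m]≡n j≤d ⟩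
    d                                   ≡⟨ geo ⟨
    dist a b                            ≤⟨ dist-minimal detour ⟩
    i ℕ.+ (fᵢ ℕ.+ (fⱼ ℕ.+ (d ∸ j)))     ≡⟨ ℕₚ.+-assoc i fᵢ _ ⟨
    i ℕ.+ fᵢ ℕ.+ (fⱼ ℕ.+ (d ∸ j))       ≡⟨ ℕₚ.+-assoc (i ℕ.+ fᵢ) fⱼ _ ⟨
    i ℕ.+ fᵢ ℕ.+ fⱼ ℕ.+ (d ∸ j)         ∎)
    where
    open ℕₚ.≤-Reasoning
    fᵢ = dist u (vertexAt W i)
    fⱼ = dist u (vertexAt W j)
    detour = take W (ℕₚ.≤-trans i≤j j≤d)
          ++ (reverse (shortest u (vertexAt W i)) ++ (shortest u (vertexAt W j) ++ drop W j≤d))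

  geodesic-load≤6 : ∀ {a b d} (W : Walk G a b d) → dist a b ≡ d → ∀ u →
                    ∑[ j < 3 ℕ.+ d ] weight (dist u (vertexAt W (endsTwiceAlong d j))) ℚ.≤ ℕ→ℚ 6
  geodesic-load≤6 {d = d} W geo u with helly-ℕ d (λ i → dist u (vertexAt W i)) (geodesic-detour W geo u)
  ... | p , p≤d , near = begin
    ∑[ j < 3 ℕ.+ d ] weight (dist u (vertexAt W (endsTwiceAlong d j)))
      ≤⟨ sum-mono-≤ (λ j → weight-antitone (near (endsTwiceAlong≤ d j))) ⟩
    ∑[ j < 3 ℕ.+ d ] weight ∣ endsTwiceAlong d j - p ∣
      ≡⟨ weight-profile p≤d ⟩
    ℕ→ℚ 6 ∎
    where open ℚₚ.≤-Reasoning

  diameter-bound : ∀ {d x} → IsDiameter dist d → Feasible dist x → ℕ→ℚ d + ℕ→ℚ 3 ℚ.≤ ℕ→ℚ 6 * objective x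
  diameter-bound {d} {x} (_ , a , b , geo) feasible = begin
    ℕ→ℚ d + ℕ→ℚ 3
      ≡⟨ trans (ℕ→ℚ-+ 3 d) (ℚₚ.+-comm (ℕ→ℚ 3) (ℕ→ℚ d)) ⟨
    ℕ→ℚ (3 ℕ.+ d)
      ≡⟨ ℚₚ.*-identityˡ _ ⟨
    1ℚ * ℕ→ℚ (3 ℕ.+ d)
      ≤⟨ weak-duality dist x feasible (vertexAt W ∘ endsTwiceAlong d) 1ℚ (ℕ→ℚ 6) (ℕ→ℚ-nonNeg 1)
           (λ u → ℚₚ.≤-trans (ℚₚ.≤-reflexive (ℚₚ.*-identityˡ _)) (geodesic-load≤6 W geo u)) ⟩
    ℕ→ℚ 6 * objective x ∎
    where
    open ℚₚ.≤-Reasoning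
    W : Walk G a b d
    W = subst (Walk G a b) geo (shortest a b)

  sphere-zero : ∀ u → sphere dist u 0 ≤ 1
  sphere-zero u = ℕₚ.≤-trans (ℕₚ.≤-reflexive (sum-single ℕₚ.+-0-commutativeMonoid _ u only-u)) (𝟙≤1 (dist u u ℕ.≟ 0))
    where
    only-u : ∀ v → v ≢ u → 𝟙 (dist v u ℕ.≟ 0) ≡ 0
    only-u v v≢u = 𝟙-no (dist v u ℕ.≟ 0) (v≢u ∘ dist≡0⇒≡)

  module _ {Δ} (degree≤Δ : ∀ v → degree G v ≤ Δ) (u : Fin n) where

    neighbours≤Δ : ∀ p → sumℕ (λ v → 𝟙 (adj G p v Boolₚ.≟ true)) ≤ Δ
    neighbours≤Δ p = ℕₚ.≤-trans (ℕₚ.≤-reflexive (sym (degree≡sumℕ G p))) (degree≤Δ p)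

    sphere-one : sphere dist u 1 ≤ Δ
    sphere-one = ℕₚ.≤-trans (sumℕ-mono-≤ neighbour) (neighbours≤Δ u)
      where
      neighbour : ∀ v → 𝟙 (dist v u ℕ.≟ 1) ≤ 𝟙 (adj G u v Boolₚ.≟ true)
      neighbour v = 𝟙-≤ (dist v u ℕ.≟ 1) λ d≡1 → adjacent (shortest-step d≡1)
        where
        adjacent : ∃[ w ] adj G v w ≡ true × dist w u ≡ 0 → 1 ≤ 𝟙 (adj G u v Boolₚ.≟ true)
        adjacent (w , v~w , dw≡0) = ℕₚ.≤-reflexive (sym (𝟙-yes (adj G u v Boolₚ.≟ true)
          (trans (Graph.sym G u v) (subst (λ w → adj G v w ≡ true) (dist≡0⇒≡ dw≡0) v~w))))

    neighbourAt : ℕ → Fin n → Fin n → ℕ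
    neighbourAt k p v = 𝟙 (adj G p v Boolₚ.≟ true) ℕ.* 𝟙 (dist v u ℕ.≟ k)

    -- a vertex at distance k+1 from u has a neighbour at distance k, hence at most Δ-1 at distance k+2
    outward-neighbours : ∀ {p k} → dist p u ≡ suc k → sumℕ (neighbourAt (suc (suc k)) p) ≤ Δ ∸ 1
    outward-neighbours {p} {k} d≡1+k with shortest-step d≡1+k
    ... | z , p~z , dz≡k = ℕₚ.∸-monoˡ-≤ 1 (ℕₚ.≤-trans fewer (neighbours≤Δ p))
      where
      z-inward : neighbourAt (suc (suc k)) p z < 𝟙 (adj G p z Boolₚ.≟ true)
      z-inward rewrite p~z | 𝟙-no (dist z u ℕ.≟ suc (suc k)) (ℕₚ.m≢1+n+m k {1} ∘ trans (sym dz≡k)) = ℕₚ.≤-refl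
      fewer = sumℕ-mono-< (λ v → 𝟙*𝟙≤𝟙 (adj G p v Boolₚ.≟ true) (dist v u ℕ.≟ suc (suc k))) z z-inward

    sphere-suc : ∀ k → sphere dist u (suc (suc k)) ≤ (Δ ∸ 1) ℕ.* sphere dist u (suc k)
    sphere-suc k = begin
      sphere dist u (suc (suc k))
        ≤⟨ sumℕ-mono-≤ has-inward-neighbour ⟩
      sumℕ (λ v → sumℕ (λ p → crossing p v))
        ≡⟨ sumℕ-comm (λ v p → crossing p v) ⟩
      sumℕ (λ p → sumℕ (λ v → crossing p v))
        ≤⟨ sumℕ-mono-≤ few-outward ⟩
      sumℕ (λ p → 𝟙 (dist p u ℕ.≟ suc k) ℕ.* (Δ ∸ 1))
        ≡⟨ sumℕ-cong-≗ (λ p → ℕₚ.*-comm (𝟙 (dist p u ℕ.≟ suc k)) (Δ ∸ 1)) ⟩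
      sumℕ (λ p → (Δ ∸ 1) ℕ.* 𝟙 (dist p u ℕ.≟ suc k))
        ≡⟨ *-distribˡ-sumℕ {n} (Δ ∸ 1) (λ p → 𝟙 (dist p u ℕ.≟ suc k)) ⟨
      (Δ ∸ 1) ℕ.* sphere dist u (suc k) ∎
      where
      open ℕₚ.≤-Reasoning
      crossing : Fin n → Fin n → ℕ
      crossing p v = 𝟙 (dist p u ℕ.≟ suc k) ℕ.* neighbourAt (suc (suc k)) p v
      has-inward-neighbour : ∀ v → 𝟙 (dist v u ℕ.≟ suc (suc k)) ≤ sumℕ (λ p → crossing p v)
      has-inward-neighbour v = 𝟙-≤ (dist v u ℕ.≟ suc (suc k)) λ d≡2+k → inward d≡2+k (shortest-step d≡2+k)
        where
        inward : dist v u ≡ suc (suc k) → ∃[ w ] adj G v w ≡ true × dist w u ≡ suc k →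
                 1 ≤ sumℕ (λ p → crossing p v)
        inward d≡2+k (w , v~w , dw≡1+k) =
          ℕₚ.≤-trans (ℕₚ.≤-reflexive (sym crossing≡1)) (term≤sumℕ (λ p → crossing p v) w)
          where
          crossing≡1 : crossing w v ≡ 1
          crossing≡1 rewrite 𝟙-yes (dist w u ℕ.≟ suc k) dw≡1+k
                           | 𝟙-yes (dist v u ℕ.≟ suc (suc k)) d≡2+k
                           | 𝟙-yes (adj G w v Boolₚ.≟ true) (trans (Graph.sym G w v) v~w) = refl
      few-outward : ∀ p → sumℕ (λ v → crossing p v) ≤ 𝟙 (dist p u ℕ.≟ suc k) ℕ.* (Δ ∸ 1)
      few-outward p rewrite sym (*-distribˡ-sumℕ (𝟙 (dist p u ℕ.≟ suc k)) (neighbourAt (suc (suc k)) p))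
        with dist p u ℕ.≟ suc k
      ... | no  _     = z≤n
      ... | yes d≡1+k = ℕₚ.*-monoʳ-≤ 1 (outward-neighbours d≡1+k)

    sphere≤ : ∀ k → sphere dist u (suc k) ≤ Δ ℕ.* (Δ ∸ 1) ℕ.^ k
    sphere≤ zero    = ℕₚ.≤-trans sphere-one (ℕₚ.≤-reflexive (sym (ℕₚ.*-identityʳ Δ)))
    sphere≤ (suc k) = begin
      sphere dist u (suc (suc k))                 ≤⟨ sphere-suc k ⟩
      (Δ ∸ 1) ℕ.* sphere dist u (suc k)           ≤⟨ ℕₚ.*-monoʳ-≤ (Δ ∸ 1) (sphere≤ k) ⟩
      (Δ ∸ 1) ℕ.* (Δ ℕ.* (Δ ∸ 1) ℕ.^ k)           ≡⟨ ℕₚ.*-comm (Δ ∸ 1) _ ⟩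
      Δ ℕ.* (Δ ∸ 1) ℕ.^ k ℕ.* (Δ ∸ 1)             ≡⟨ ℕₚ.*-assoc Δ _ (Δ ∸ 1) ⟩
      Δ ℕ.* ((Δ ∸ 1) ℕ.^ k ℕ.* (Δ ∸ 1))           ≡⟨ cong (Δ ℕ.*_) (ℕₚ.*-comm _ (Δ ∸ 1)) ⟩
      Δ ℕ.* (Δ ∸ 1) ℕ.^ suc k                     ∎
      where open ℕₚ.≤-Reasoning

  load-bound : ∀ {Δ d} → (∀ v → degree G v ≤ Δ) → (∀ u v → dist u v ≤ d) → ∀ u →
               ∑[ v < n ] weight (dist u v) ℚ.≤ ℕ→ℚ 2 + ℕ→ℚ Δ * ∑[ k < d ] growth Δ ^ℚ toℕ k
  load-bound {Δ} {d} degree≤Δ dist≤d u = begin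
    ∑[ v < n ] weight (dist u v)
      ≡⟨ sum-cong-≗ {n} (cong weight ∘ dist-sym u) ⟩
    ∑[ v < n ] weight (dist v u)
      ≡⟨ sum-by-level d (λ v → dist v u) weight (λ v → dist≤d v u) ⟩
    ℕ→ℚ (sphere dist u 0) * ℕ→ℚ 2 + ∑[ k < d ] (ℕ→ℚ (sphere dist u (suc (toℕ k))) * ½ ^ℚ toℕ k)
      ≤⟨ ℚₚ.+-mono-≤ (ℚₚ.*-monoʳ-≤-nonNeg (ℕ→ℚ 2) {{ℚ.nonNegative (ℕ→ℚ-nonNeg 2)}} (ℕ→ℚ-mono-≤ (sphere-zero u)))
                     (sum-mono-≤ {d} (λ k → ℚₚ.*-monoʳ-≤-nonNeg (½ ^ℚ toℕ k) {{ℚ.nonNegative (weight-nonNeg (suc (toℕ k)))}}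
                                          (ℕ→ℚ-mono-≤ (sphere≤ degree≤Δ u (toℕ k))))) ⟩
    1ℚ * ℕ→ℚ 2 + ∑[ k < d ] (ℕ→ℚ (Δ ℕ.* (Δ ∸ 1) ℕ.^ toℕ k) * ½ ^ℚ toℕ k)
      ≡⟨ cong₂ _+_ (ℚₚ.*-identityˡ (ℕ→ℚ 2)) (trans (sum-cong-≗ {d} per-level) (sym (*-distribˡ-sum {d} (ℕ→ℚ Δ) _))) ⟩
    ℕ→ℚ 2 + ℕ→ℚ Δ * ∑[ k < d ] growth Δ ^ℚ toℕ k ∎
    where
    open ℚₚ.≤-Reasoning
    per-level : ∀ k → ℕ→ℚ (Δ ℕ.* (Δ ∸ 1) ℕ.^ toℕ k) * ½ ^ℚ toℕ k ≡ ℕ→ℚ Δ * growth Δ ^ℚ toℕ k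
    per-level k = begin-equality
      ℕ→ℚ (Δ ℕ.* (Δ ∸ 1) ℕ.^ toℕ k) * ½ ^ℚ toℕ k          ≡⟨ cong (_* ½ ^ℚ toℕ k) (ℕ→ℚ-* Δ _) ⟩
      ℕ→ℚ Δ * ℕ→ℚ ((Δ ∸ 1) ℕ.^ toℕ k) * ½ ^ℚ toℕ k        ≡⟨ ℚₚ.*-assoc (ℕ→ℚ Δ) _ _ ⟩
      ℕ→ℚ Δ * (ℕ→ℚ ((Δ ∸ 1) ℕ.^ toℕ k) * ½ ^ℚ toℕ k)      ≡⟨ cong (ℕ→ℚ Δ *_) (ℕ→ℚ-^*½^ (Δ ∸ 1) (toℕ k)) ⟩
      ℕ→ℚ Δ * growth Δ ^ℚ toℕ k                          ∎

  degree-bound : ∀ {Δ d x} (c : ℚ) → 0ℚ ℚ.≤ c → (∀ v → degree G v ≤ Δ) → (∀ u v → dist u v ≤ d) → Feasible dist x →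
                 c * ℕ→ℚ n ℚ.≤ (c * (ℕ→ℚ 2 + ℕ→ℚ Δ * ∑[ k < d ] growth Δ ^ℚ toℕ k)) * objective x
  degree-bound {x = x} c c≥0 degree≤Δ dist≤d feasible = weak-duality dist x feasible (λ v → v) c _ c≥0
    (λ u → ℚₚ.*-monoˡ-≤-nonNeg c {{ℚ.nonNegative c≥0}} (load-bound degree≤Δ dist≤d u))

  cubic-bound : ∀ {d x} → (∀ v → degree G v ≤ 3) → (∀ u v → dist u v ≤ d) → Feasible dist x →
                ℕ→ℚ n ℚ.≤ (ℕ→ℚ 2 + ℕ→ℚ 3 * ℕ→ℚ d) * objective x
  cubic-bound {d} {x} degree≤3 dist≤d feasible = begin
    ℕ→ℚ n
      ≡⟨ ℚₚ.*-identityˡ (ℕ→ℚ n) ⟨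
    1ℚ * ℕ→ℚ n
      ≤⟨ degree-bound 1ℚ (ℕ→ℚ-nonNeg 1) degree≤3 dist≤d feasible ⟩
    (1ℚ * (ℕ→ℚ 2 + ℕ→ℚ 3 * ∑[ k < d ] growth 3 ^ℚ toℕ k)) * objective x
      ≡⟨ cong (_* objective x) (trans (ℚₚ.*-identityˡ _) (cong (λ s → ℕ→ℚ 2 + ℕ→ℚ 3 * s) ∑1≡d)) ⟩
    (ℕ→ℚ 2 + ℕ→ℚ 3 * ℕ→ℚ d) * objective x ∎
    where
    open ℚₚ.≤-Reasoning
    -- growth 3 = 2 / 2 computes to 1ℚ
    ∑1≡d : ∑[ k < d ] growth 3 ^ℚ toℕ k ≡ ℕ→ℚ d
    ∑1≡d = trans (sum-cong-≗ {d} (1^ℚ ∘ toℕ)) (trans (sum-const d 1ℚ) (ℚₚ.*-identityʳ (ℕ→ℚ d)))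

  large-degree-bound : ∀ {Δ d x} → 3 ≤ Δ → (∀ v → degree G v ≤ Δ) → (∀ u v → dist u v ≤ d) → Feasible dist x →
                       (growth Δ - ℕ→ℚ 1) * ℕ→ℚ n ℚ.≤ (ℕ→ℚ Δ * growth Δ ^ℚ d - ℕ→ℚ 3) * objective x
  large-degree-bound {suc (suc (suc t))} {d} {x} (s≤s (s≤s (s≤s z≤n))) degree≤Δ dist≤d feasible = begin
    (growth Δ - ℕ→ℚ 1) * ℕ→ℚ n
      ≤⟨ degree-bound _ c≥0 degree≤Δ dist≤d feasible ⟩
    ((growth Δ - ℕ→ℚ 1) * (ℕ→ℚ 2 + ℕ→ℚ Δ * ∑[ k < d ] growth Δ ^ℚ toℕ k)) * objective x
      ≡⟨ cong (_* objective x) (growth-identity (suc (suc t)) d) ⟩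
    (ℕ→ℚ Δ * growth Δ ^ℚ d - ℕ→ℚ 3) * objective x ∎
    where
    open ℚₚ.≤-Reasoning
    Δ = suc (suc (suc t))
    c≥0 : 0ℚ ℚ.≤ growth Δ - ℕ→ℚ 1
    c≥0 = ℚₚ.≤-trans (ℚₚ.*-monoˡ-≤-nonNeg ½ (ℕ→ℚ-nonNeg t)) (ℚₚ.≤-reflexive (sym (begin-equality
      growth Δ - ℕ→ℚ 1
        ≡⟨ cong (_- ℕ→ℚ 1) (trans ([m/2]≡½*m (2 ℕ.+ t)) (cong (½ *_) (ℕ→ℚ-+ 2 t))) ⟩
      ½ * (ℕ→ℚ 2 + ℕ→ℚ t) - ℕ→ℚ 1
        ≡⟨ solve 1 (λ T → con ½ :* (con (ℕ→ℚ 2) :+ T) :- con (ℕ→ℚ 1) := con ½ :* T) refl (ℕ→ℚ t) ⟩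
      ½ * ℕ→ℚ t ∎)))
      where open ℚSolver

theorem4 : (n : ℕ) (G : Graph n) (dist : Fin n → Fin n → ℕ)
    → IsDist G dist → Connected G
    → (Δ d : ℕ) → IsMaxDegree G Δ → IsDiameter dist d
    → (x : Fin n → ℚ) → Feasible dist x
    → (ℕ→ℚ d + ℕ→ℚ 3 Data.Rational.≤ ℕ→ℚ 6 * objective x)
      × (Δ ≡ 3 → ℕ→ℚ n Data.Rational.≤ (ℕ→ℚ 2 + ℕ→ℚ 3 * ℕ→ℚ d) * objective x)
      × (4 ≤ Δ
         → (((+ (Δ Data.Nat.∸ 1)) / 2 - ℕ→ℚ 1) * ℕ→ℚ n)
           Data.Rational.≤
           ((ℕ→ℚ Δ * (((+ (Δ Data.Nat.∸ 1)) / 2) ^ℚ d) - ℕ→ℚ 3) * objective x))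
theorem4 n G dist isDist _ Δ d (degree≤Δ , _) diameter x feasible =
    diameter-bound isDist diameter feasible
  , (λ { refl → cubic-bound isDist degree≤Δ dist≤d feasible })
  , (λ 4≤Δ → large-degree-bound isDist (ℕₚ.≤-trans (ℕₚ.n≤1+n 3) 4≤Δ) degree≤Δ dist≤d feasible)
  where
  dist≤d = proj₁ diameter
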